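{- Let $G=(V_0\cup V_1,E)$ be a connected bipartite graph with partite sets $V_0,V_1$ that is an absolute retract of bipartite graphs, and assume $\mathrm{diam}(H_0)\le \mathrm{diam}(H_1)$. Then $\mathrm{diam}(G)\in\{2\,\mathrm{diam}(H_1),\,2\,\mathrm{diam}(H_1)+1\}$. Moreover, if $\mathrm{diam}(G)\ge 3$, then $\mathrm{diam}(G)=2\,\mathrm{diam}(H_1)+1$ if and only if either $\mathrm{diam}(H_1)=1$, or $\mathrm{diam}(H_0)=\mathrm{diam}(H_1)$ and, for some $i\in\{0,1\}$, there is a peripheral vertex of $H_i$ all of whose neighbours in $G$ are peripheral vertices of $H_{1-i}$.
   Context: Graphs are finite, simple (no loops), connected. For $i\in\{0,1\}$, $H_i$ is the graph with vertex set $V_i$ and an edge between every two distinct vertices having a common neighbour in $G$. $e_H(v)=\max_u d_H(u,v)$, $\mathrm{diam}(H)=\max_v e_H(v)$, and a vertex $v$ is peripheral in $H$ if $e_H(v)=\mathrm{diam}(H)$. A subgraph $H$ of $G'$ is isometric if distances between vertices of $H$ agree in $H$ and $G'$, isochromatic if same chromatic number. A retract of $G'$ is the image of $G'$ under an idempotent edge-preserving map. An absolute retract of bipartite graphs is a bipartite graph $H$ such that whenever $H$ is an isometric and isochromatic subgraph of a bipartite graph $G'$, $H$ is a retract of $G'$. -}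

module Defs where

open import Data.Nat using (ℕ; zero; suc; _≤_)
open import Data.Fin using (Fin)
open import Data.Bool using (Bool; true; false; not)
open import Data.Unit using (⊤)
open import Data.Product using (Σ; _×_; _,_)
open import Relation.Binary.PropositionalEquality using (_≡_; _≢_)
open import Function.Definitions using (Injective)

record Graph : Set where
  field
    n      : ℕ
    adj    : Fin n → Fin n → Bool
    sym    : ∀ u v → adj u v ≡ adj v u
    irrefl : ∀ v → adj v v ≡ false

open Graph public

Edge : (G : Graph) → Fin (n G) → Fin (n G) → Set
Edge G u v = adj G u v ≡ true

module Metric {V : Set} (In : V → Set) (Adj : V → V → Set) where

  data Walk : V → V → ℕ → Set where
    nil  : ∀ {v} → In v → Walk v v zero
    cons : ∀ {u w v k} → In u → Adj u w → Walk w v k → Walk u v (suc k)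

  IsDist : V → V → ℕ → Set
  IsDist u v k = Walk u v k × (∀ j → Walk u v j → k ≤ j)

  IsEcc : V → ℕ → Set
  IsEcc v e = In v
            × (∀ u → In u → Σ ℕ λ k → IsDist u v k × k ≤ e)
            × Σ V λ u → In u × IsDist u v e

  IsDiam : ℕ → Set
  IsDiam D = (∀ v → In v → Σ ℕ λ e → IsEcc v e × e ≤ D)
           × Σ V λ v → IsEcc v D

  Peripheral : V → Set
  Peripheral v = Σ ℕ λ e → IsEcc v e × IsDiam e

  Connected : Set
  Connected = ∀ u v → In u → In v → Σ ℕ λ k → Walk u v k

AllV : (G : Graph) → Fin (n G) → Set
AllV G _ = ⊤

module GM (G : Graph) = Metric (AllV G) (Edge G)

ConnectedG : Graph → Set
ConnectedG G = GM.Connected G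

DistG : (G : Graph) → Fin (n G) → Fin (n G) → ℕ → Set
DistG G = GM.IsDist G

DiamG : Graph → ℕ → Set
DiamG G = GM.IsDiam G

-- H_i : vertex set V_i = {v | side v ≡ i}, two distinct vertices adjacent
-- iff they have a common neighbour in G.

InSide : (G : Graph) → (Fin (n G) → Bool) → Bool → Fin (n G) → Set
InSide G side i v = side v ≡ i

CommonNbr : (G : Graph) → Fin (n G) → Fin (n G) → Set
CommonNbr G u v = u ≢ v × Σ (Fin (n G)) λ w → Edge G u w × Edge G w v

module HM (G : Graph) (side : Fin (n G) → Bool) (i : Bool) =
  Metric (InSide G side i) (CommonNbr G)

DiamH : (G : Graph) → (Fin (n G) → Bool) → Bool → ℕ → Set
DiamH G side i = HM.IsDiam G side i

PeripheralH : (G : Graph) → (Fin (n G) → Bool) → Bool → Fin (n G) → Set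
PeripheralH G side i = HM.Peripheral G side i

Colouring : (G : Graph) → ℕ → Set
Colouring G k = Σ (Fin (n G) → Fin k) λ c → ∀ u v → Edge G u v → c u ≢ c v

IsChromaticNumber : Graph → ℕ → Set
IsChromaticNumber G k = Colouring G k × (∀ j → Colouring G j → k ≤ j)

-- proper 2-colouring with colours Bool; the colour classes are V_0
-- (false) and V_1 (true)
ProperBipartition : (G : Graph) → (Fin (n G) → Bool) → Set
ProperBipartition G side = ∀ u v → Edge G u v → side u ≢ side v

Bipartite : Graph → Set
Bipartite G = Σ (Fin (n G) → Bool) λ side → ProperBipartition G side

IsSubgraphMap : (H G' : Graph) → (Fin (n H) → Fin (n G')) → Set
IsSubgraphMap H G' f = Injective _≡_ _≡_ f
                     × (∀ u v → Edge H u v → Edge G' (f u) (f v))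

Isometric : (H G' : Graph) → (Fin (n H) → Fin (n G')) → Set
Isometric H G' f = ∀ u v k → (DistG H u v k → DistG G' (f u) (f v) k)
                           × (DistG G' (f u) (f v) k → DistG H u v k)

Isochromatic : Graph → Graph → Set
Isochromatic H G' = Σ ℕ λ k → IsChromaticNumber H k × IsChromaticNumber G' k

-- H (embedded by f) is a retract of G': there is an edge-preserving
-- r : G' → H with r ∘ f = id  (equivalently, f ∘ r is an idempotent
-- edge-preserving self-map of G' whose image is H)
IsRetract : (H G' : Graph) → (Fin (n H) → Fin (n G')) → Set
IsRetract H G' f = Σ (Fin (n G') → Fin (n H)) λ r →
                     (∀ u v → Edge G' u v → Edge H (r u) (r v))
                   × (∀ v → r (f v) ≡ v)

AbsoluteRetractBip : Graph → Set
AbsoluteRetractBip H =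
  Bipartite H ×
  ((G' : Graph) → ConnectedG G' → Bipartite G' →
   (f : Fin (n H) → Fin (n G')) → IsSubgraphMap H G' f →
   Isometric H G' f → Isochromatic H G' → IsRetract H G' f)

module Submission where

-- Walks in G between vertices of one side and walks in H_i correspond, with lengths doubled
-- and halved, which gives 2 D₁ ≤ diam G ≤ 2 D₁ + 1.
-- If diam G = 2 D₁ + 1, let u, c be a diametral pair; they lie on opposite sides. A short
-- H-walk from c to a neighbour of u, or from the last-but-one vertex of the walk to u, would
-- shorten the diametral walk, so D₀ = D₁ and u and all its neighbours are peripheral.
-- Conversely, suppose diam G = 2 D₁ ≥ 4 and all neighbours of v are peripheral. Attach to G a
-- hub adjacent to v and joined by paths of length L = 2 D₁ − 2 to every vertex on the side
-- opposite to v. Since by parity v is within L + 1 of that side, the result is an isometric,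
-- isochromatic bipartite extension, so it retracts onto G. The hub is sent to a neighbour of
-- v within L of the whole opposite side, whereas a peripheral vertex of that side has another
-- vertex of the side at G-distance 2 D₁ > L.

open import Defs
open import Algebra.Properties.CommutativeSemigroup using (xy∙z≈xz∙y)
open import Data.Bool using (Bool; true; false; not)
import Data.Bool as Bool
open import Data.Bool.Properties using (not-involutive; ¬-not; not-¬)
open import Data.Empty using (⊥; ⊥-elim)
open import Data.Fin using (Fin; toℕ; fromℕ<)
import Data.Fin as Fin
open import Data.Fin.Properties using (2↔Bool; 1↔⊤; +↔⊎; *↔×; toℕ-fromℕ<; fromℕ<-toℕ; toℕ<n)
open import Data.Nat using (ℕ; zero; suc; _≤_; _<_; _+_; _*_; _∸_; z≤n; s≤s; s≤s⁻¹; _≤?_)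
import Data.Nat as ℕ
open import Data.Nat.Properties
  using ( ≤-refl; ≤-trans; ≤-antisym; ≤-reflexive; ≰⇒>; ≤∧≢⇒<; 1+n≰n; 1+n≢n; n≤1+n; m≤n⇒m≤1+n
        ; m≤n+m; +-monoˡ-≤; ∸-monoʳ-≤; n∸n≡0; +-suc; +-comm; +-identityʳ; +-commutativeSemigroup
        ; module ≤-Reasoning)
open import Data.Product using (Σ; _×_; _,_; proj₁; proj₂)
open import Data.Sum using (_⊎_; inj₁; inj₂)
import Data.Sum as Sum
open import Data.Sum.Properties using (inj₁-injective)
open import Data.Sum.Function.Propositional using (_⊎-↔_)
open import Data.Unit using (⊤; tt)
open import Function using (_∘_; case_of_)
open import Function.Bundles using (_⇔_; _↔_; Inverse; Injection; mk⇔)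
open import Function.Construct.Composition using (_↔-∘_)
open import Function.Construct.Identity using (↔-id)
open import Function.Properties.Inverse using (↔-sym; ↔⇒↣)
open import Relation.Binary.PropositionalEquality
  using (_≡_; _≢_; refl; trans; cong; subst; subst₂; module ≡-Reasoning)
  renaming (sym to ≡-sym)
open import Relation.Nullary using (¬_; yes; no; Dec; does)
open import Relation.Nullary.Decidable using (dec-true; dec-false; does-⇔; _⊎-dec_; _×-dec_)

double : ℕ → ℕ
double zero    = zero
double (suc k) = suc (suc (double k))

double≡2* : ∀ k → double k ≡ 2 * k
double≡2* zero    = refl
double≡2* (suc k) = cong suc (trans (cong suc (double≡2* k)) (≡-sym (+-suc k (k + 0))))

double≡n+n : ∀ k → double k ≡ k + k
double≡n+n zero    = refl
double≡n+n (suc k) = cong suc (trans (cong suc (double≡n+n k)) (≡-sym (+-suc k k)))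

n≤double : ∀ k → k ≤ double k
n≤double zero    = z≤n
n≤double (suc k) = s≤s (m≤n⇒m≤1+n (n≤double k))

double-mono-≤ : ∀ {j k} → j ≤ k → double j ≤ double k
double-mono-≤ z≤n     = z≤n
double-mono-≤ (s≤s p) = s≤s (s≤s (double-mono-≤ p))

suc-double≡2*+1 : ∀ k → suc (double k) ≡ 2 * k + 1
suc-double≡2*+1 k = trans (cong suc (double≡2* k)) (+-comm 1 (2 * k))

3≤double⇒≥2 : ∀ {d} → 3 ≤ double d → Σ ℕ λ e → d ≡ suc (suc e)
3≤double⇒≥2 {suc zero}    (s≤s (s≤s ()))
3≤double⇒≥2 {suc (suc e)} _ = e , refl

double-cancel-≤ : ∀ {j k} → double j ≤ suc (double k) → j ≤ k
double-cancel-≤ {zero}          _             = z≤n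
double-cancel-≤ {suc j} {zero}  (s≤s ())
double-cancel-≤ {suc j} {suc k} (s≤s (s≤s p)) = s≤s (double-cancel-≤ p)

_⊕_ : Bool → ℕ → Bool
b ⊕ zero  = b
b ⊕ suc k = not (b ⊕ k)

not-⊕ : ∀ b k → not b ⊕ k ≡ not (b ⊕ k)
not-⊕ b zero    = refl
not-⊕ b (suc k) = cong not (not-⊕ b k)

⊕-double : ∀ b k → b ⊕ double k ≡ b
⊕-double b zero    = refl
⊕-double b (suc k) = trans (not-involutive _) (⊕-double b k)

module Walks {V : Set} (In : V → Set) (Adj : V → V → Set) where
  open Metric In Adj public

  _++ʷ_ : ∀ {a b c k l} → Walk a b k → Walk b c l → Walk a c (k + l)
  nil _       ++ʷ w′ = w′
  cons ia e w ++ʷ w′ = cons ia e (w ++ʷ w′)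

  _∷ʳʷ_ : ∀ {a b c k} → Walk a b k → In c × Adj b c → Walk a c (suc k)
  nil ib      ∷ʳʷ (ic , e′) = cons ib e′ (nil ic)
  cons ia e w ∷ʳʷ last      = cons ia e (w ∷ʳʷ last)

  reverse : (∀ {u w} → Adj u w → Adj w u) → ∀ {a b k} → Walk a b k → Walk b a k
  reverse adj-sym (nil i)       = nil i
  reverse adj-sym (cons ia e w) = reverse adj-sym w ∷ʳʷ (ia , adj-sym e)

  IsDist-functional : ∀ {u v k k′} → IsDist u v k → IsDist u v k′ → k ≡ k′
  IsDist-functional (w , min) (w′ , min′) = ≤-antisym (min _ w′) (min′ _ w)

  IsEcc-functional : ∀ {v e e′} → IsEcc v e → IsEcc v e′ → e ≡ e′
  IsEcc-functional = λ p q → ≤-antisym (≤ecc q p) (≤ecc p q)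
    where
    ≤ecc : ∀ {v e e′} → IsEcc v e → IsEcc v e′ → e′ ≤ e
    ≤ecc (_ , bound , _) (_ , _ , u , iu , d′) with bound u iu
    ... | k , d , k≤e = subst (_≤ _) (IsDist-functional d d′) k≤e

  IsDiam-functional : ∀ {D D′} → IsDiam D → IsDiam D′ → D ≡ D′
  IsDiam-functional = λ p q → ≤-antisym (≤diam q p) (≤diam p q)
    where
    ≤diam : ∀ {D D′} → IsDiam D → IsDiam D′ → D′ ≤ D
    ≤diam (bound , _) (_ , v , ecc′) with bound v (proj₁ ecc′)
    ... | e , ecc , e≤D = subst (_≤ _) (IsEcc-functional ecc ecc′) e≤D

  walk-within-diam : ∀ {D u v} → IsDiam D → In u → In v → Σ ℕ λ k → Walk u v k × k ≤ D
  walk-within-diam (bound , _) iu iv with bound _ iv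
  ... | e , (_ , ecc-bound , _) , e≤D with ecc-bound _ iu
  ... | k , (w , _) , k≤e = k , w , ≤-trans k≤e e≤D

  far-pair⇒≤ecc : ∀ {D x t l} → IsDiam D → In x → In t → (∀ k → Walk t x k → l ≤ k) →
                  Σ ℕ λ e → IsEcc x e × l ≤ e × e ≤ D
  far-pair⇒≤ecc (bound , _) ix it far with bound _ ix
  ... | e , ecc@(_ , ecc-bound , _) , e≤D with ecc-bound _ it
  ... | k , (w , _) , k≤e = e , ecc , ≤-trans (far k w) k≤e , e≤D

  far-pair⇒≤diam : ∀ {D x t l} → IsDiam D → In x → In t → (∀ k → Walk t x k → l ≤ k) → l ≤ D
  far-pair⇒≤diam diam ix it far with far-pair⇒≤ecc diam ix it far
  ... | _ , _ , l≤e , e≤D = ≤-trans l≤e e≤D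

  far-pair⇒peripheral : ∀ {D x t} → IsDiam D → In x → In t → (∀ k → Walk t x k → D ≤ k) → Peripheral x
  far-pair⇒peripheral diam ix it far with far-pair⇒≤ecc diam ix it far
  ... | e , ecc , D≤e , e≤D = e , ecc , subst IsDiam (≤-antisym D≤e e≤D) diam

module _ {V W : Set} {R : V → V → Set} {S : W → W → Set} where
  private
    module R = Walks (λ (_ : V) → ⊤) R
    module S = Walks (λ (_ : W) → ⊤) S

  map-walk : (h : V → W) → (∀ {u w} → R u w → S (h u) (h w)) →
             ∀ {u w k} → R.Walk u w k → S.Walk (h u) (h w) k
  map-walk h hom (R.nil _)      = S.nil tt
  map-walk h hom (R.cons _ e w) = S.cons tt (hom e) (map-walk h hom w)

module Bipartite (G : Graph) (side : Fin (n G) → Bool) (proper : ProperBipartition G side) where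
  module GW = Walks (AllV G) (Edge G)
  module HW (b : Bool) = Walks (InSide G side b) (CommonNbr G)

  edge-sym : ∀ {u w} → Edge G u w → Edge G w u
  edge-sym {u} {w} e = trans (Graph.sym G w u) e

  walk-reverse : ∀ {a c k} → GW.Walk a c k → GW.Walk c a k
  walk-reverse = GW.reverse edge-sym

  edge-side : ∀ {u w} → Edge G u w → side w ≡ not (side u)
  edge-side e = ¬-not (proper _ _ (edge-sym e))

  walk-side : ∀ {a c k} → GW.Walk a c k → side c ≡ side a ⊕ k
  walk-side (GW.nil _) = refl
  walk-side {a} {c} (GW.cons {w = w} {k = k} _ e rest) = begin
    side c             ≡⟨ walk-side rest ⟩
    side w ⊕ k         ≡⟨ cong (_⊕ k) (edge-side e) ⟩
    not (side a) ⊕ k   ≡⟨ not-⊕ (side a) k ⟩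
    not (side a ⊕ k)   ∎
    where open ≡-Reasoning

  first-step : ∀ {a c k} → GW.Walk a c (suc k) → Σ (Fin (n G)) λ y → Edge G a y
  first-step (GW.cons _ e _) = _ , e

  NeighboursPeripheral : Bool → Fin (n G) → Set
  NeighboursPeripheral i v = ∀ w → Edge G v w → PeripheralH G side (not i) w

  PeripheralWithPeripheralNeighbours : Set
  PeripheralWithPeripheralNeighbours =
    Σ Bool λ i → Σ (Fin (n G)) λ v → side v ≡ i × PeripheralH G side i v × NeighboursPeripheral i v

  H-walk⇒walk : ∀ {b a c j} → HW.Walk b a c j → GW.Walk a c (double j)
  H-walk⇒walk (HW.nil _)                          = GW.nil tt
  H-walk⇒walk (HW.cons _ (_ , _ , e₁ , e₂) rest) = GW.cons tt e₁ (GW.cons tt e₂ (H-walk⇒walk rest))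

  walk⇒H-walk : ∀ {b a c k} → GW.Walk a c k → side a ≡ b → side c ≡ b →
                Σ ℕ λ j → HW.Walk b a c j × double j ≤ k
  walk⇒H-walk (GW.nil _) sa _ = 0 , HW.nil sa , z≤n
  walk⇒H-walk (GW.cons _ e (GW.nil _)) sa sc = ⊥-elim (proper _ _ e (trans sa (≡-sym sc)))
  walk⇒H-walk {b} {a} (GW.cons {w = w} _ e₁ (GW.cons {w = y} _ e₂ rest)) sa sc
    with walk⇒H-walk rest sy sc | a Fin.≟ y
    where
    sy : side y ≡ b
    sy = trans (edge-side e₂) (trans (cong not (edge-side e₁)) (trans (not-involutive _) sa))
  ... | j , hw , 2j≤k | yes refl = j , hw , m≤n⇒m≤1+n (m≤n⇒m≤1+n 2j≤k)
  ... | j , hw , 2j≤k | no a≢y   = suc j , HW.cons sa (a≢y , w , e₁ , e₂) hw , s≤s (s≤s 2j≤k)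

bipartite⇒chromatic-2 : (H : Graph) → Bipartite H → ∀ {a b} → Edge H a b → IsChromaticNumber H 2
bipartite⇒chromatic-2 H (side , proper) {a} {b} a~b = (colour , colour-proper) , at-least-two
  where
  bool↔fin : Bool ↔ Fin 2
  bool↔fin = ↔-sym 2↔Bool
  colour : Fin (n H) → Fin 2
  colour = Inverse.to bool↔fin ∘ side
  colour-proper : ∀ u w → Edge H u w → colour u ≢ colour w
  colour-proper u w e = proper u w e ∘ Injection.injective (↔⇒↣ bool↔fin)
  at-least-two : ∀ k → Colouring H k → 2 ≤ k
  at-least-two 0 (c , _) with c a
  ... | ()
  at-least-two 1 (c , c-proper) with c a | c b | c-proper a b a~b
  ... | Fin.zero | Fin.zero | ca≢cb = ⊥-elim (ca≢cb refl)
  at-least-two (suc (suc k)) _ = s≤s (s≤s z≤n)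

module DecidableGraph {V : Set} {N : ℕ} (enc : V ↔ Fin N)
  (R : V → V → Set) (R? : ∀ u w → Dec (R u w))
  (R-sym : ∀ {u w} → R u w → R w u) (R-irrefl : ∀ u → ¬ R u u) where
  open Inverse enc

  graph : Graph
  graph = record
    { n      = N
    ; adj    = λ s t → does (R? (from s) (from t))
    ; sym    = λ s t → does-⇔ (mk⇔ R-sym R-sym) (R? (from s) (from t)) (R? (from t) (from s))
    ; irrefl = λ s → dec-false (R? (from s) (from s)) (R-irrefl (from s))
    }

  edge⁺ : ∀ {u w} → R u w → Edge graph (to u) (to w)
  edge⁺ {u} {w} r rewrite strictlyInverseʳ u | strictlyInverseʳ w = dec-true (R? u w) r

  edge⁻ : ∀ {s t} → Edge graph s t → R (from s) (from t)
  edge⁻ {s} {t} e with R? (from s) (from t) | e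
  ... | yes r | _ = r

  module RW = Walks (λ (_ : V) → ⊤) R
  module W⁺ = Walks (AllV graph) (Edge graph)

  walk⁺ : ∀ {u w k} → RW.Walk u w k → W⁺.Walk (to u) (to w) k
  walk⁺ = map-walk to edge⁺

  walk⁻ : ∀ {s t k} → W⁺.Walk s t k → RW.Walk (from s) (from t) k
  walk⁻ = map-walk from edge⁻

isometric-if-shortcut : (H G′ : Graph) (f : Fin (n H) → Fin (n G′)) →
  (∀ {a b k} → GM.Walk H a b k → GM.Walk G′ (f a) (f b) k) →
  (∀ {a b j} → GM.Walk G′ (f a) (f b) j → Σ ℕ λ q → GM.Walk H a b q × q ≤ j) →
  Isometric H G′ f
isometric-if-shortcut H G′ f lift shortcut a b k = preserve , reflect
  where
  preserve : DistG H a b k → DistG G′ (f a) (f b) k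
  preserve (w , shortest) =
    lift w , λ j w′ → let q , w″ , q≤j = shortcut w′ in ≤-trans (shortest q w″) q≤j
  reflect : DistG G′ (f a) (f b) k → DistG H a b k
  reflect (w′ , shortest) with shortcut w′
  ... | q , w , q≤k with ≤-antisym q≤k (shortest q (lift w))
  ... | refl = w , λ j w″ → shortest j (lift w″)

Consecutive : ℕ → ℕ → Set
Consecutive j l = suc j ≡ l ⊎ suc l ≡ j

consecutive? : ∀ j l → Dec (Consecutive j l)
consecutive? j l = (suc j ℕ.≟ l) ⊎-dec (suc l ℕ.≟ j)

consecutive-sym : ∀ {j l} → Consecutive j l → Consecutive l j
consecutive-sym (inj₁ p) = inj₂ p
consecutive-sym (inj₂ p) = inj₁ p

consecutive⇒≤suc : ∀ {j l} → Consecutive j l → j ≤ suc l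
consecutive⇒≤suc (inj₁ refl) = m≤n⇒m≤1+n (n≤1+n _)
consecutive⇒≤suc (inj₂ refl) = ≤-refl

∸≤suc-∸suc : ∀ a b → a ∸ b ≤ suc (a ∸ suc b)
∸≤suc-∸suc zero    zero    = z≤n
∸≤suc-∸suc zero    (suc b) = z≤n
∸≤suc-∸suc (suc a) zero    = ≤-refl
∸≤suc-∸suc (suc a) (suc b) = ∸≤suc-∸suc a b

consecutive⇒∸≤suc : ∀ a {j l} → Consecutive j l → a ∸ j ≤ suc (a ∸ l)
consecutive⇒∸≤suc a {j} (inj₁ refl) = ∸≤suc-∸suc a j
consecutive⇒∸≤suc a {l = l} (inj₂ refl) = m≤n⇒m≤1+n (∸-monoʳ-≤ a (n≤1+n l))

-- G⁺ adds to G a hub adjacent to v and, for every x, a path hub – (x,0) – … – (x,m) whose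
-- end is joined to x when x lies on the side opposite to v; paths for the other x dangle.
-- The hub is then at distance L from that whole side.
module Extension (G : Graph) (side : Fin (n G) → Bool) (proper : ProperBipartition G side)
  (v : Fin (n G)) (e : ℕ) where
  open Bipartite G side proper

  i : Bool
  i = side v

  m M L : ℕ
  m = double e
  M = suc m
  L = suc M

  Far : Fin (n G) → Set
  Far x = side x ≡ not i

  V⁺ : Set
  V⁺ = Fin (n G) ⊎ (⊤ ⊎ (Fin (n G) × Fin M))

  pattern hub        = inj₂ (inj₁ tt)
  pattern path x k   = inj₂ (inj₂ (x , k))

  R : V⁺ → V⁺ → Set
  R (inj₁ a)   (inj₁ b)   = Edge G a b
  R (inj₁ a)   hub        = a ≡ v
  R (inj₁ a)   (path y k) = a ≡ y × Far y × toℕ k ≡ m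
  R hub        (inj₁ b)   = b ≡ v
  R hub        hub        = ⊥
  R hub        (path y k) = toℕ k ≡ 0
  R (path x k) (inj₁ b)   = b ≡ x × Far x × toℕ k ≡ m
  R (path x k) hub        = toℕ k ≡ 0
  R (path x k) (path y l) = x ≡ y × Consecutive (toℕ k) (toℕ l)

  R? : ∀ u w → Dec (R u w)
  R? (inj₁ a)   (inj₁ b)   = adj G a b Bool.≟ true
  R? (inj₁ a)   hub        = a Fin.≟ v
  R? (inj₁ a)   (path y k) = (a Fin.≟ y) ×-dec (side y Bool.≟ not i) ×-dec (toℕ k ℕ.≟ m)
  R? hub        (inj₁ b)   = b Fin.≟ v
  R? hub        hub        = no λ ()
  R? hub        (path y k) = toℕ k ℕ.≟ 0
  R? (path x k) (inj₁ b)   = (b Fin.≟ x) ×-dec (side x Bool.≟ not i) ×-dec (toℕ k ℕ.≟ m)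
  R? (path x k) hub        = toℕ k ℕ.≟ 0
  R? (path x k) (path y l) = (x Fin.≟ y) ×-dec consecutive? (toℕ k) (toℕ l)

  R-sym : ∀ {u w} → R u w → R w u
  R-sym {inj₁ _}   {inj₁ _}   a~b             = edge-sym a~b
  R-sym {inj₁ _}   {hub}      a≡v             = a≡v
  R-sym {inj₁ _}   {path _ _} (refl , far , k) = refl , far , k
  R-sym {hub}      {inj₁ _}   b≡v             = b≡v
  R-sym {hub}      {path _ _} k≡0             = k≡0
  R-sym {path _ _} {inj₁ _}   (refl , far , k) = refl , far , k
  R-sym {path _ _} {hub}      k≡0             = k≡0
  R-sym {path _ _} {path _ _} (refl , kl)     = refl , consecutive-sym kl

  R-irrefl : ∀ u → ¬ R u u
  R-irrefl (inj₁ a) a~a = case trans (≡-sym a~a) (Graph.irrefl G a) of λ ()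
  R-irrefl (path x k) (_ , inj₁ k+1≡k) = 1+n≢n k+1≡k
  R-irrefl (path x k) (_ , inj₂ k+1≡k) = 1+n≢n k+1≡k

  side⁺ : V⁺ → Bool
  side⁺ (inj₁ a)   = side a
  side⁺ hub        = not i
  side⁺ (path x k) = i ⊕ toℕ k

  side⁺-proper : ∀ {u w} → R u w → side⁺ u ≢ side⁺ w
  side⁺-proper {inj₁ a}   {inj₁ b}   a~b = proper a b a~b
  side⁺-proper {inj₁ _}   {hub}      refl = not-¬ refl
  side⁺-proper {inj₁ _}   {path _ k} (refl , far , k≡m) rewrite far | k≡m | ⊕-double i e =
    not-¬ refl ∘ ≡-sym
  side⁺-proper {hub}      {inj₁ _}   refl = not-¬ refl ∘ ≡-sym
  side⁺-proper {hub}      {path _ k} k≡0 rewrite k≡0 = not-¬ refl ∘ ≡-sym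
  side⁺-proper {path _ k} {inj₁ _}   (refl , far , k≡m) rewrite far | k≡m | ⊕-double i e =
    not-¬ refl
  side⁺-proper {path _ k} {hub}      k≡0 rewrite k≡0 = not-¬ refl
  side⁺-proper {path _ k} {path _ l} (refl , inj₁ k+1≡l) rewrite ≡-sym k+1≡l = not-¬ refl
  side⁺-proper {path _ k} {path _ l} (refl , inj₂ l+1≡k) rewrite ≡-sym l+1≡k = not-¬ refl ∘ ≡-sym

  enc : V⁺ ↔ Fin (n G + suc (n G * M))
  enc = ↔-sym ((↔-id _ ⊎-↔ ((1↔⊤ ⊎-↔ *↔×) ↔-∘ +↔⊎)) ↔-∘ +↔⊎)

  open DecidableGraph enc R R? R-sym R-irrefl public renaming (graph to G⁺)
  open Inverse enc using (to; from; strictlyInverseˡ; strictlyInverseʳ)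

  ι : Fin (n G) → Fin (n G⁺)
  ι a = to (inj₁ a)

  ι-walk : ∀ {a b k} → GW.Walk a b k → W⁺.Walk (ι a) (ι b) k
  ι-walk = map-walk ι (edge⁺ {inj₁ _} {inj₁ _})

  descend : ∀ x j (j<M : j < M) → RW.Walk (path x (fromℕ< j<M)) hub (suc j)
  descend x zero    j<M = RW.cons tt (toℕ-fromℕ< j<M) (RW.nil tt)
  descend x (suc j) j<M = RW.cons tt (refl , inj₂ one-down) (descend x j j<M′)
    where
    j<M′ : j < M
    j<M′ = ≤-trans (n≤1+n (suc j)) j<M
    one-down : suc (toℕ (fromℕ< j<M′)) ≡ toℕ (fromℕ< j<M)
    one-down = trans (cong suc (toℕ-fromℕ< j<M′)) (≡-sym (toℕ-fromℕ< j<M))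

  path-to-hub : ∀ x k → RW.Walk (path x k) hub (suc (toℕ k))
  path-to-hub x k = subst (λ k′ → RW.Walk (path x k′) hub (suc (toℕ k)))
                          (fromℕ<-toℕ k (toℕ<n k)) (descend x (toℕ k) (toℕ<n k))

  hub-to-far : ∀ {x} → Far x → RW.Walk hub (inj₁ x) L
  hub-to-far {x} far =
    RW.reverse R-sym (descend x m ≤-refl) RW.∷ʳʷ (tt , refl , far , toℕ-fromℕ< ≤-refl)

  walk-to-v : ConnectedG G → ∀ u → Σ ℕ λ k → RW.Walk u (inj₁ v) k
  walk-to-v conn (inj₁ a)   = let k , w = conn a v tt tt in k , map-walk inj₁ (λ a~b → a~b) w
  walk-to-v conn hub        = 1 , RW.cons tt refl (RW.nil tt)
  walk-to-v conn (path x k) = _ , path-to-hub x k RW.++ʷ RW.cons tt refl (RW.nil tt)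

  connected⁺ : ConnectedG G → ConnectedG G⁺
  connected⁺ conn s t _ _ with walk-to-v conn (from s) | walk-to-v conn (from t)
  ... | k , w | l , w′ =
    k + l , subst₂ (λ s t → W⁺.Walk s t (k + l)) (strictlyInverseˡ s) (strictlyInverseˡ t)
                   (walk⁺ (w RW.++ʷ RW.reverse R-sym w′))

  module Shortcut
    (v-near   : ∀ {x} → Far x → Σ ℕ λ q → GW.Walk v x q × q ≤ suc L)
    (far-near : ∀ {x x′} → Far x → Far x′ → Σ ℕ λ q → GW.Walk x x′ q × q ≤ double L) where

    -- Exit u b c: the gadget leads from u into G at b in c steps. Every walk from u to a vertex t
    -- of G is at least as long as one of these exits followed by a G-walk from b to t.
    Exit : V⁺ → Fin (n G) → ℕ → Set
    Exit (inj₁ a)   b c = b ≡ a × c ≡ 0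
    Exit hub        b c = (b ≡ v × c ≡ 1) ⊎ (Far b × c ≡ L)
    Exit (path x k) b c = (b ≡ v × c ≡ 2 + toℕ k)
                        ⊎ (Far b × c ≡ suc (toℕ k) + L)
                        ⊎ (b ≡ x × Far x × c ≡ suc (m ∸ toℕ k))

    Reach : V⁺ → Fin (n G) → ℕ → Set
    Reach u t j = Σ (Fin (n G)) λ b → Σ ℕ λ c → Exit u b c × Σ ℕ λ q → GW.Walk b t q × q + c ≤ j

    exit-reach : ∀ {u b c j} → Exit u b c → c ≤ j → Reach u b j
    exit-reach ex c≤j = _ , _ , ex , 0 , GW.nil tt , c≤j

    base-reach : ∀ {a t q j} → GW.Walk a t q → q ≤ j → Reach (inj₁ a) t j
    base-reach {q = q} w q≤j = _ , 0 , (refl , refl) , q , w , subst (_≤ _) (≡-sym (+-identityʳ q)) q≤j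

    exit-step-base : ∀ {a w b′ c′} → R (inj₁ a) w → Exit w b′ c′ → Reach (inj₁ a) b′ (suc c′)
    exit-step-base {w = inj₁ _} a~b (refl , refl) = base-reach (GW.cons tt a~b (GW.nil tt)) ≤-refl
    exit-step-base {w = hub} refl (inj₁ (refl , refl)) = base-reach (GW.nil tt) z≤n
    exit-step-base {w = hub} refl (inj₂ (far , refl))  = let q , w , q≤ = v-near far in base-reach w q≤
    exit-step-base {w = path _ k} (refl , far , k≡m) (inj₁ (refl , refl)) rewrite k≡m =
      let q , w , q≤ = v-near far in base-reach (walk-reverse w) q≤
    exit-step-base {w = path _ k} (refl , far , k≡m) (inj₂ (inj₁ (far′ , refl))) rewrite k≡m =
      let q , w , q≤ = far-near far far′ in base-reach w (≤-trans q≤ (≤-reflexive (double≡n+n L)))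
    exit-step-base {w = path _ _} (refl , _) (inj₂ (inj₂ (refl , _ , refl))) = base-reach (GW.nil tt) z≤n

    exit-step-hub : ∀ {w b′ c′} → R hub w → Exit w b′ c′ → Reach hub b′ (suc c′)
    exit-step-hub {inj₁ _} refl (refl , refl) = exit-reach {hub} (inj₁ (refl , refl)) ≤-refl
    exit-step-hub {path _ _} k≡0 (inj₁ (refl , refl)) = exit-reach {hub} (inj₁ (refl , refl)) (s≤s z≤n)
    exit-step-hub {path _ k} k≡0 (inj₂ (inj₁ (far , refl))) =
      exit-reach {hub} (inj₂ (far , refl)) (m≤n⇒m≤1+n (m≤n+m L (suc (toℕ k))))
    exit-step-hub {path _ _} k≡0 (inj₂ (inj₂ (refl , far , refl))) rewrite k≡0 =
      exit-reach {hub} (inj₂ (far , refl)) ≤-refl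

    exit-step-path : ∀ {x k w b′ c′} → R (path x k) w → Exit w b′ c′ → Reach (path x k) b′ (suc c′)
    exit-step-path {k = k} {inj₁ _} (refl , far , k≡m) (refl , refl) =
      exit-reach {path _ k} (inj₂ (inj₂ (refl , far , refl)))
        (≤-reflexive (cong suc (trans (cong (m ∸_) k≡m) (n∸n≡0 m))))
    exit-step-path {w = hub} k≡0 (inj₁ (refl , refl)) rewrite k≡0 =
      exit-reach {path _ _} (inj₁ (refl , refl)) ≤-refl
    exit-step-path {w = hub} k≡0 (inj₂ (far , refl)) rewrite k≡0 =
      exit-reach {path _ _} (inj₂ (inj₁ (far , refl))) ≤-refl
    exit-step-path {w = path _ _} (refl , kl) (inj₁ (refl , refl)) =
      exit-reach {path _ _} (inj₁ (refl , refl)) (s≤s (s≤s (consecutive⇒≤suc kl)))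
    exit-step-path {w = path _ _} (refl , kl) (inj₂ (inj₁ (far , refl))) =
      exit-reach {path _ _} (inj₂ (inj₁ (far , refl))) (s≤s (+-monoˡ-≤ L (consecutive⇒≤suc kl)))
    exit-step-path {w = path _ _} (refl , kl) (inj₂ (inj₂ (refl , far , refl))) =
      exit-reach {path _ _} (inj₂ (inj₂ (refl , far , refl))) (s≤s (consecutive⇒∸≤suc m kl))

    exit-step : ∀ {u w b′ c′} → R u w → Exit w b′ c′ → Reach u b′ (suc c′)
    exit-step {inj₁ _}   = exit-step-base
    exit-step {hub}      = exit-step-hub
    exit-step {path _ _} = exit-step-path

    walk⇒reach : ∀ {u t j} → RW.Walk u (inj₁ t) j → Reach u t j
    walk⇒reach (RW.nil _) = base-reach (GW.nil tt) z≤n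
    walk⇒reach (RW.cons _ u~w rest) with walk⇒reach rest
    ... | _ , _ , ex′ , q₁ , w₁ , le₁ with exit-step u~w ex′
    ... | _ , _ , ex , q₀ , w₀ , le₀ = _ , _ , ex , q₀ + q₁ , w₀ GW.++ʷ w₁ , budget {q₀} {q₁} le₀ le₁
      where
      budget : ∀ {q₀ q₁ c c′ j} → q₀ + c ≤ suc c′ → q₁ + c′ ≤ j → (q₀ + q₁) + c ≤ suc j
      budget {q₀} {q₁} {c} {c′} {j} le₀ le₁ = begin
        (q₀ + q₁) + c   ≡⟨ xy∙z≈xz∙y +-commutativeSemigroup q₀ q₁ c ⟩
        (q₀ + c) + q₁   ≤⟨ +-monoˡ-≤ q₁ le₀ ⟩
        suc (c′ + q₁)   ≡⟨ cong suc (+-comm c′ q₁) ⟩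
        suc (q₁ + c′)   ≤⟨ s≤s le₁ ⟩
        suc j           ∎
        where open ≤-Reasoning

    shortcut : ∀ {a t j} → W⁺.Walk (ι a) (ι t) j → Σ ℕ λ q → GW.Walk a t q × q ≤ j
    shortcut {a} {t} {j} w⁺
      with walk⇒reach (subst₂ (λ u w → RW.Walk u w j)
                              (strictlyInverseʳ (inj₁ a)) (strictlyInverseʳ (inj₁ t)) (walk⁻ w⁺))
    ... | _ , _ , (refl , refl) , q , w , q+0≤j = q , w , subst (_≤ j) (+-identityʳ q) q+0≤j

  embedding : IsSubgraphMap G G⁺ ι
  embedding = inj₁-injective ∘ Injection.injective (↔⇒↣ enc) , λ _ _ a~b → edge⁺ {inj₁ _} {inj₁ _} a~b

  proper⁺ : ProperBipartition G⁺ (side⁺ ∘ from)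
  proper⁺ _ _ s~t = side⁺-proper (edge⁻ s~t)

  retract-hub : ConnectedG G → AbsoluteRetractBip G → ∀ {a b} → Edge G a b →
    (∀ {x} → Far x → Σ ℕ λ q → GW.Walk v x q × q ≤ suc L) →
    (∀ {x x′} → Far x → Far x′ → Σ ℕ λ q → GW.Walk x x′ q × q ≤ double L) →
    Σ (Fin (n G)) λ w → Edge G v w × (∀ {x} → Far x → GW.Walk w x L)
  retract-hub conn (_ , retract) a~b v-near far-near
    with retract G⁺ (connected⁺ conn) (side⁺ ∘ from , proper⁺) ι embedding
           (isometric-if-shortcut G G⁺ ι ι-walk shortcut)
           (2 , bipartite⇒chromatic-2 G (side , proper) a~b
              , bipartite⇒chromatic-2 G⁺ (side⁺ ∘ from , proper⁺) (edge⁺ {inj₁ _} {inj₁ _} a~b))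
    where open Shortcut v-near far-near
  ... | r , r-hom , r∘ι≡id =
    r (to hub) ,
    subst (λ y → Edge G y (r (to hub))) (r∘ι≡id v) (r-hom _ _ (edge⁺ {inj₁ v} {hub} refl)) ,
    λ far → subst (λ x → GW.Walk (r (to hub)) x L) (r∘ι≡id _)
                  (map-walk (r ∘ to) (r-hom _ _ ∘ edge⁺) (hub-to-far far))

module Diameters (G : Graph) (side : Fin (n G) → Bool) (proper : ProperBipartition G side)
  {D0 D1 D : ℕ} (diam₀ : DiamH G side false D0) (diam₁ : DiamH G side true D1) (diam : DiamG G D)
  (D0≤D1 : D0 ≤ D1) where
  open Bipartite G side proper

  diamH : Bool → ℕ
  diamH false = D0
  diamH true  = D1

  IsDiam-diamH : ∀ b → HW.IsDiam b (diamH b)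
  IsDiam-diamH false = diam₀
  IsDiam-diamH true  = diam₁

  diamH≤D1 : ∀ b → diamH b ≤ D1
  diamH≤D1 false = D0≤D1
  diamH≤D1 true  = ≤-refl

  D0≡D1-if-both-≥ : ∀ b → D1 ≤ diamH b → D1 ≤ diamH (not b) → D0 ≡ D1
  D0≡D1-if-both-≥ false D1≤D0 _ = ≤-antisym D0≤D1 D1≤D0
  D0≡D1-if-both-≥ true  _ D1≤D0 = ≤-antisym D0≤D1 D1≤D0

  IsDiam-D1 : D0 ≡ D1 → ∀ b → HW.IsDiam b D1
  IsDiam-D1 D0≡D1 false = subst (HW.IsDiam false) D0≡D1 diam₀
  IsDiam-D1 _     true  = diam₁

  same-side-walk : ∀ {u c} → side u ≡ side c → Σ ℕ λ k → GW.Walk u c k × k ≤ double D1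
  same-side-walk {c = c} su≡sc with HW.walk-within-diam (side c) (IsDiam-diamH (side c)) su≡sc refl
  ... | j , hw , j≤ = double j , H-walk⇒walk hw , double-mono-≤ (≤-trans j≤ (diamH≤D1 (side c)))

  short-walk : ∀ u c → Σ ℕ λ k → GW.Walk u c k × k ≤ suc (double D1)
  short-walk u c with side u Bool.≟ side c
  ... | yes su≡sc with same-side-walk su≡sc
  ...   | k , w , k≤ = k , w , m≤n⇒m≤1+n k≤
  short-walk u c | no su≢sc with GW.walk-within-diam {u = u} {c} diam tt tt
  ... | _ , GW.nil _ , _           = ⊥-elim (su≢sc refl)
  ... | _ , GW.cons _ u~w _ , _
        with same-side-walk (trans (edge-side u~w) (≡-sym (¬-not (su≢sc ∘ ≡-sym))))
  ...     | k , w , k≤ = suc k , GW.cons tt u~w w , s≤s k≤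

  double-D1≤D : double D1 ≤ D
  double-D1≤D with proj₂ diam₁
  ... | a , (sa , _ , u , su , (_ , shortest)) with GW.walk-within-diam diam tt tt
  ... | k , w , k≤D with walk⇒H-walk w su sa
  ... | j , hw , 2j≤k = ≤-trans (double-mono-≤ (shortest j hw)) (≤-trans 2j≤k k≤D)

  D≤1+double-D1 : D ≤ suc (double D1)
  D≤1+double-D1 with proj₂ diam
  ... | c , (_ , _ , u , _ , (_ , shortest)) with short-walk u c
  ... | k , w , k≤ = ≤-trans (shortest k w) k≤

  diam-cases : D ≡ double D1 ⊎ D ≡ suc (double D1)
  diam-cases with D ≤? double D1
  ... | yes D≤ = inj₁ (≤-antisym D≤ double-D1≤D)
  ... | no D≰ = inj₂ (≤-antisym D≤1+double-D1 (≰⇒> D≰))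

  module OddDiameter (odd : D ≡ suc (double D1)) {u c} (u-c : GW.IsDist u c D) where
    i : Bool
    i = side u

    shortest : ∀ {j} → GW.Walk u c (suc (double j)) → D1 ≤ j
    shortest w = double-cancel-≤ (m≤n⇒m≤1+n (s≤s⁻¹ (subst (_≤ _) odd (proj₂ u-c _ w))))

    c-side : side c ≡ not i
    c-side = begin
      side c                ≡⟨ walk-side (proj₁ u-c) ⟩
      i ⊕ D                 ≡⟨ cong (i ⊕_) odd ⟩
      not (i ⊕ double D1)   ≡⟨ cong not (⊕-double i D1) ⟩
      not i                 ∎
      where open ≡-Reasoning

    neighbour-far : ∀ {w} → Edge G u w → ∀ j → HW.Walk (not i) c w j → D1 ≤ j
    neighbour-far u~w j hw = shortest (GW.cons tt u~w (walk-reverse (H-walk⇒walk hw)))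

    w₀ : Fin (n G)
    w₀ = proj₁ (first-step (subst (GW.Walk u c) odd (proj₁ u-c)))

    u~w₀ : Edge G u w₀
    u~w₀ = proj₂ (first-step (subst (GW.Walk u c) odd (proj₁ u-c)))

    y : Fin (n G)
    y = proj₁ (first-step (subst (GW.Walk c u) odd (walk-reverse (proj₁ u-c))))

    c~y : Edge G c y
    c~y = proj₂ (first-step (subst (GW.Walk c u) odd (walk-reverse (proj₁ u-c))))

    y-side : side y ≡ i
    y-side = trans (edge-side c~y) (trans (cong not c-side) (not-involutive i))

    u-far : ∀ j → HW.Walk i y u j → D1 ≤ j
    u-far j hw = shortest (walk-reverse (GW.cons tt c~y (H-walk⇒walk hw)))

    D0≡D1 : D0 ≡ D1
    D0≡D1 = D0≡D1-if-both-≥ i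
      (HW.far-pair⇒≤diam i (IsDiam-diamH i) refl y-side u-far)
      (HW.far-pair⇒≤diam (not i) (IsDiam-diamH (not i)) (edge-side u~w₀) c-side (neighbour-far u~w₀))

    u-peripheral : PeripheralH G side i u
    u-peripheral = HW.far-pair⇒peripheral i (IsDiam-D1 D0≡D1 i) refl y-side u-far

    neighbours-peripheral : NeighboursPeripheral i u
    neighbours-peripheral w u~w = HW.far-pair⇒peripheral (not i)
      (IsDiam-D1 D0≡D1 (not i)) (edge-side u~w) c-side (neighbour-far u~w)

  odd-diam⇒peripheral-neighbourhood : D ≡ suc (double D1) → D0 ≡ D1 × PeripheralWithPeripheralNeighbours
  odd-diam⇒peripheral-neighbourhood odd with proj₂ diam
  ... | _ , (_ , _ , u , _ , u-c) = D0≡D1 , i , u , refl , u-peripheral , neighbours-peripheral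
    where open OddDiameter odd u-c

  module EvenDiameter (conn : ConnectedG G) (AR : AbsoluteRetractBip G) (D0≡D1 : D0 ≡ D1)
    {e : ℕ} (D1≡2+e : D1 ≡ suc (suc e)) (even : D ≡ double D1) (v : Fin (n G)) where
    open Extension G side proper v e using (i; L; Far; retract-hub)

    D≡2+L : D ≡ suc (suc L)
    D≡2+L = trans even (cong double D1≡2+e)

    v-near : ∀ {x} → Far x → Σ ℕ λ q → GW.Walk v x q × q ≤ suc L
    v-near {x} far with GW.walk-within-diam {u = v} {x} diam tt tt
    ... | k , w , k≤D = k , w , s≤s⁻¹ (≤∧≢⇒< (subst (k ≤_) D≡2+L k≤D) k≢2+L)
      where
      k≢2+L : k ≢ suc (suc L)
      k≢2+L refl = not-¬ refl (trans (≡-sym (trans (walk-side w) (⊕-double i (suc (suc e))))) far)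

    far-near : ∀ {x x′} → Far x → Far x′ → Σ ℕ λ q → GW.Walk x x′ q × q ≤ double L
    far-near {x} {x′} _ _ with GW.walk-within-diam {u = x} {x′} diam tt tt
    ... | k , w , k≤D =
      k , w , ≤-trans k≤D (≤-trans (≤-reflexive D≡2+L) (double-mono-≤ (s≤s (s≤s (n≤double e)))))

    some-edge : Σ (Fin (n G)) λ a → Σ (Fin (n G)) λ b → Edge G a b
    some-edge with proj₂ diam
    ... | c , (_ , _ , u , _ , (w , _)) = u , first-step (subst (GW.Walk u c) D≡2+L w)

    ¬neighbours-peripheral : NeighboursPeripheral i v → ⊥
    ¬neighbours-peripheral nbrs with retract-hub conn AR (proj₂ (proj₂ some-edge)) v-near far-near
    ... | w , v~w , hub-image-near with nbrs w v~w
    ... | ecc , (_ , _ , t , t-far , (_ , shortest)) , diam-ecc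
          with walk⇒H-walk (walk-reverse (hub-image-near t-far)) t-far (edge-side v~w)
    ... | j , hw , 2j≤L = 1+n≰n (≤-trans (n≤1+n (suc L)) (begin
          suc (suc L)  ≡⟨ ≡-sym D≡2+L ⟩
          D            ≡⟨ even ⟩
          double D1    ≤⟨ double-mono-≤ D1≤j ⟩
          double j     ≤⟨ 2j≤L ⟩
          L            ∎))
      where
      open ≤-Reasoning
      D1≤j : D1 ≤ j
      D1≤j = subst (_≤ j) (HW.IsDiam-functional (not i) diam-ecc (IsDiam-D1 D0≡D1 (not i)))
                   (shortest j hw)

  even-diam⇒¬neighbours-peripheral :
    ConnectedG G → AbsoluteRetractBip G → D0 ≡ D1 → 3 ≤ D → D ≡ double D1 →
    ∀ {i v} → side v ≡ i → NeighboursPeripheral i v → ⊥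
  even-diam⇒¬neighbours-peripheral conn AR D0≡D1 3≤D even {v = v} refl
    with 3≤double⇒≥2 (subst (3 ≤_) even 3≤D)
  ... | _ , D1≡2+e = EvenDiameter.¬neighbours-peripheral conn AR D0≡D1 D1≡2+e even v

  criterion⇒odd-diam : ConnectedG G → AbsoluteRetractBip G → 3 ≤ D →
    D1 ≡ 1 ⊎ (D0 ≡ D1 × PeripheralWithPeripheralNeighbours) → D ≡ suc (double D1)
  criterion⇒odd-diam _ _ 3≤D (inj₁ D1≡1) =
    ≤-antisym D≤1+double-D1 (subst (λ d → suc (double d) ≤ D) (≡-sym D1≡1) 3≤D)
  criterion⇒odd-diam conn AR 3≤D (inj₂ (D0≡D1 , _ , _ , sv , _ , nbrs)) with diam-cases
  ... | inj₁ even = ⊥-elim (even-diam⇒¬neighbours-peripheral conn AR D0≡D1 3≤D even sv nbrs)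
  ... | inj₂ odd  = odd

lemma3 : (G : Graph) → ConnectedG G →
    (side : Fin (n G) → Bool) → ProperBipartition G side →
    AbsoluteRetractBip G →
    (D0 D1 D : ℕ) → DiamH G side false D0 → DiamH G side true D1 → DiamG G D →
    D0 ≤ D1 →
    (D ≡ 2 * D1 ⊎ D ≡ 2 * D1 + 1)
    × (3 ≤ D →
       (D ≡ 2 * D1 + 1 ⇔
        (D1 ≡ 1 ⊎
         (D0 ≡ D1 ×
          Σ Bool λ i → Σ (Fin (n G)) λ v →
            side v ≡ i × PeripheralH G side i v ×
            (∀ w → Edge G v w → PeripheralH G side (not i) w)))))
lemma3 G conn side proper AR D0 D1 D diam₀ diam₁ diam D0≤D1 =
  Sum.map (λ even → trans even (double≡2* D1)) (λ odd → trans odd (suc-double≡2*+1 D1)) diam-cases ,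
  λ 3≤D → mk⇔ (λ odd → inj₂ (odd-diam⇒peripheral-neighbourhood
                                (trans odd (≡-sym (suc-double≡2*+1 D1)))))
               (λ cond → trans (criterion⇒odd-diam conn AR 3≤D cond) (suc-double≡2*+1 D1))
  where open Diameters G side proper diam₀ diam₁ diam D0≤D1
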